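{- Let $G=(V,E)$ be a finite simple undirected graph, let $k>0$ be an integer, and let $u\in V$. If for every $v\in V\setminus N[u]$ we have $\omega(G[N(u)])-k>\omega(G[N(v)])$, then $\theta(G,k)=\theta(G[V\setminus\{u\}],k-1)$.
   Context: $N(x)=\{w:\{x,w\}\in E\}$ is the open neighborhood and $N[x]=N(x)\cup\{x\}$ the closed neighborhood. For $S\subseteq V$, $G[S]$ is the induced subgraph; $\omega(H)$ is the size of a largest clique in $H$; and for a nonnegative integer $k$, $\theta(G,k)=\min_{S\subseteq V,\ |S|\le k}\omega(G[V\setminus S])$. -}

module Defs where

open import Data.Nat using (ℕ; zero; suc; _⊔_; _⊓_; _≤ᵇ_)
open import Data.Bool using (Bool; true; false; _∧_; _∨_; not; if_then_else_)
open import Data.Fin using (Fin)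
open import Data.Fin.Properties using (_≟_)
open import Data.Fin.Subset using (Subset; _∪_; _─_; ⁅_⁆; ∣_∣)
open import Data.Fin.Subset.Properties using (_⊆?_)
open import Data.Vec using (Vec; []; _∷_; lookup; tabulate)
open import Data.List using (List; []; _∷_; _++_; map; foldr; filterᵇ)
open import Data.Bool.ListAction using (and)
open import Data.List using () renaming ([_] to [_]ˡ)
open import Data.List.Base using (allFin)
open import Relation.Nullary using (does)
open import Relation.Binary.PropositionalEquality using (_≡_)

record Graph (n : ℕ) : Set where
  field
    adj     : Fin n → Fin n → Bool
    sym     : ∀ i j → adj i j ≡ adj j i
    irrefl  : ∀ i → adj i i ≡ false
open Graph public

module _ {n : ℕ} (G : Graph n) where

  N : Fin n → Subset n
  N x = tabulate (λ w → adj G x w)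

  N[_] : Fin n → Subset n
  N[ x ] = N x ∪ ⁅ x ⁆

  isClique : Subset n → Bool
  isClique C = and (map (λ i → and (map (λ j →
      not (lookup C i ∧ lookup C j ∧ not (does (i ≟ j))) ∨ adj G i j)
      (allFin n))) (allFin n))

allSubsets : (n : ℕ) → List (Subset n)
allSubsets zero    = [ [] ]ˡ
allSubsets (suc n) = map (true ∷_) (allSubsets n) ++ map (false ∷_) (allSubsets n)

maxList : List ℕ → ℕ
maxList = foldr _⊔_ 0

module _ {n : ℕ} (G : Graph n) where

  -- ω(G[S]) : size of a largest clique of the induced subgraph G[S]
  -- (the cliques of G[S] are exactly the cliques of G contained in S)
  ω : Subset n → ℕ
  ω S = maxList (map ∣_∣ (filterᵇ (λ C → does (C ⊆? S) ∧ isClique G C) (allSubsets n)))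

  -- θ(G[S], k) = min over T ⊆ S with |T| ≤ k of ω(G[S ∖ T]).
  -- T = ∅ is always admissible; its value ω(G[S]) seeds the minimum.
  θ : Subset n → ℕ → ℕ
  θ S k = foldr _⊓_ (ω S)
    (map (λ T → ω (S ─ T))
      (filterᵇ (λ T → does (T ⊆? S) ∧ (∣ T ∣ ≤ᵇ k)) (allSubsets n)))

-- Removing u and at most k - 1 further vertices removes at most k vertices, so
-- θ(G,k) ≤ θ(G - u, k - 1). Conversely let |S| ≤ k. If u ∈ S, then S - u is admissible for
-- G - u. Otherwise drop one vertex s of S; every clique K of G - u avoiding S - s then has
-- |K| ≤ ω(G - S), because L = K - s is a clique avoiding S and u with |L| + 1 ≤ ω(G - S):
-- either L ⊆ N(u) and L + u is a clique, or L contains some w ∉ N[u], so that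
-- |L| ≤ ω(N(w)) + 1 ≤ ω(N(u)) - k, while a maximum clique of N(u) keeps at least
-- ω(N(u)) - k vertices outside S, which together with u form a clique of G - S.
module Submission where

open import Defs
open import Data.Nat using (ℕ; _+_; _<_; _∸_; suc; _≤_; _≤ᵇ_; _⊓_; z≤n; s≤s; s≤s⁻¹)
open import Data.Nat.Properties
  using (≤-trans; ≤-reflexive; ≤-antisym; n≤1+n; +-comm; +-suc; +-monoʳ-≤; +-cancelʳ-<;
         ⊔-sel; m≤m⊔n; m≤n⊔m; ⊓-glb; m⊓n≤m; m⊓n≤n; ≤⇒≤ᵇ; ≤ᵇ⇒≤; module ≤-Reasoning)
open import Data.Bool using (Bool; true; false; T; _∧_; _∨_; not)
open import Data.Bool.Properties using (T?; T-∧; T-≡)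
open import Data.Fin using (Fin)
open import Data.Fin.Properties using (_≟_)
open import Data.Fin.Subset
  using (Subset; ⊤; ⊥; _∈_; _∉_; _⊆_; _∪_; _─_; _-_; ⁅_⁆; ∣_∣; inside; outside)
open import Data.Fin.Subset.Properties
  using (_∈?_; _⊆?_; nonempty?; Empty-unique; ∈⊤; ⊆⊤; ∉⊥; ⊆-min; x∈⁅x⁆; x∈⁅y⁆⇒x≡y;
         x∉⁅y⁆⇒x≢y; ∣⁅x⁆∣≡1; ∣⊥∣≡0; p⊆q⇒∣p∣≤∣q∣; p⊂q⇒∣p∣<∣q∣; x∈p∪q⁻; x∈p∪q⁺; p⊆p∪q;
         p─⊥≡p; p─q⊆p; ∣p─q∣≤∣p∣; p─q─r≡p─q∪r; p─q─r≡p─r─q; x∈p∧x∉q⇒x∈p─q;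
         x∈p∧x≢y⇒x∈p-y; x∈p⇒∣p-x∣<∣p∣)
open import Data.Vec using ([]; _∷_; here; there; lookup)
open import Data.Vec.Properties using ([]=⇒lookup; lookup⇒[]=; lookup∘tabulate)
open import Data.List using (List; map; foldr; filterᵇ; allFin)
open import Data.List.Membership.Propositional using () renaming (_∈_ to _∈ˡ_)
open import Data.List.Membership.Propositional.Properties
  using (∈-map⁺; ∈-map⁻; ∈-filter⁺; ∈-filter⁻; ∈-++⁺ˡ; ∈-++⁺ʳ; ∈-allFin; foldr-selective)
open import Data.List.Properties using (foldr-preservesᵇ; foldr-preservesᵒ)
open import Data.List.Relation.Unary.All as All using ()
open import Data.List.Relation.Unary.All.Properties using (all⁺; all⁻) renaming (map⁺ to All-map⁺)
open import Data.List.Relation.Unary.Any as Any using () renaming (here to hereˡ)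
open import Data.Product using (∃-syntax; _×_; _,_; proj₂)
open import Data.Sum using (inj₁; inj₂; [_,_])
open import Function using (_∘_; _$_; Equivalence)
open import Relation.Nullary using (¬_; Dec; yes; no; does; contradiction)
open import Relation.Binary.PropositionalEquality
  using (_≡_; _≢_; refl; trans; cong; subst; ≢-sym; module ≡-Reasoning)
  renaming (sym to ≡-sym)

x∈p─q⇒x∉q : ∀ {n} {x : Fin n} (p q : Subset n) → x ∈ p ─ q → x ∉ q
x∈p─q⇒x∉q (_ ∷ p) (outside ∷ q) here      ()
x∈p─q⇒x∉q (_ ∷ p) (_       ∷ q) (there m) (there x∈q) = x∈p─q⇒x∉q p q m x∈q

x∈p-y⇒x≢y : ∀ {n} {x y : Fin n} (p : Subset n) → x ∈ p - y → x ≢ y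
x∈p-y⇒x≢y {y = y} p = x∉⁅y⁆⇒x≢y ∘ x∈p─q⇒x∉q p ⁅ y ⁆

x∉p-y∧x≢y⇒x∉p : ∀ {n} {x y : Fin n} {p : Subset n} → x ∉ p - y → x ≢ y → x ∉ p
x∉p-y∧x≢y⇒x∉p x∉p-y x≢y x∈p = x∉p-y (x∈p∧x≢y⇒x∈p-y x∈p x≢y)

∣p∣≤∣p─q∣+∣q∣ : ∀ {n} (p q : Subset n) → ∣ p ∣ ≤ ∣ p ─ q ∣ + ∣ q ∣
∣p∣≤∣p─q∣+∣q∣ []            []            = z≤n
∣p∣≤∣p─q∣+∣q∣ (inside  ∷ p) (outside ∷ q) = s≤s (∣p∣≤∣p─q∣+∣q∣ p q)
∣p∣≤∣p─q∣+∣q∣ (outside ∷ p) (outside ∷ q) = ∣p∣≤∣p─q∣+∣q∣ p q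
∣p∣≤∣p─q∣+∣q∣ (inside  ∷ p) (inside  ∷ q) =
  ≤-trans (s≤s (∣p∣≤∣p─q∣+∣q∣ p q)) (≤-reflexive (≡-sym (+-suc ∣ p ─ q ∣ ∣ q ∣)))
∣p∣≤∣p─q∣+∣q∣ (outside ∷ p) (inside  ∷ q) =
  ≤-trans (∣p∣≤∣p─q∣+∣q∣ p q) (+-monoʳ-≤ ∣ p ─ q ∣ (n≤1+n ∣ q ∣))

∣p∣≤1+∣p-x∣ : ∀ {n} (p : Subset n) (x : Fin n) → ∣ p ∣ ≤ suc ∣ p - x ∣
∣p∣≤1+∣p-x∣ p x = begin
  ∣ p ∣                 ≤⟨ ∣p∣≤∣p─q∣+∣q∣ p ⁅ x ⁆ ⟩
  ∣ p - x ∣ + ∣ ⁅ x ⁆ ∣ ≡⟨ cong (∣ p - x ∣ +_) (∣⁅x⁆∣≡1 x) ⟩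
  ∣ p - x ∣ + 1         ≡⟨ +-comm ∣ p - x ∣ 1 ⟩
  suc ∣ p - x ∣         ∎
  where open ≤-Reasoning

∣p∪⁅x⁆∣≤1+∣p∣ : ∀ {n} (p : Subset n) (x : Fin n) → ∣ p ∪ ⁅ x ⁆ ∣ ≤ suc ∣ p ∣
∣p∪⁅x⁆∣≤1+∣p∣ p x = ≤-trans (∣p∣≤1+∣p-x∣ (p ∪ ⁅ x ⁆) x) (s≤s (p⊆q⇒∣p∣≤∣q∣ p∪⁅x⁆-x⊆p))
  where
  p∪⁅x⁆-x⊆p : (p ∪ ⁅ x ⁆) - x ⊆ p
  p∪⁅x⁆-x⊆p m with x∈p∪q⁻ p ⁅ x ⁆ (p─q⊆p _ _ m)
  ... | inj₁ y∈p   = y∈p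
  ... | inj₂ y∈⁅x⁆ = contradiction y∈⁅x⁆ (x∈p─q⇒x∉q _ _ m)

x∉p⇒1+∣p∣≤∣p∪⁅x⁆∣ : ∀ {n} {p : Subset n} {x : Fin n} → x ∉ p → suc ∣ p ∣ ≤ ∣ p ∪ ⁅ x ⁆ ∣
x∉p⇒1+∣p∣≤∣p∪⁅x⁆∣ {p = p} {x} x∉p =
  p⊂q⇒∣p∣<∣q∣ (p⊆p∪q {p = p} ⁅ x ⁆ , x , x∈p∪q⁺ (inj₂ (x∈⁅x⁆ x)) , x∉p)

∣p∣≤1+k⇒∃∣p-x∣≤k : ∀ {n k} (p : Subset n) → Fin n → ∣ p ∣ ≤ suc k → ∃[ x ] ∣ p - x ∣ ≤ k
∣p∣≤1+k⇒∃∣p-x∣≤k {n} p y ∣p∣≤1+k with nonempty? p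
... | yes (x , x∈p) = x , s≤s⁻¹ (≤-trans (x∈p⇒∣p-x∣<∣p∣ x∈p) ∣p∣≤1+k)
... | no p-empty    = y , ≤-trans (∣p─q∣≤∣p∣ p ⁅ y ⁆) (≤-trans ∣p∣≤0 z≤n)
  where
  ∣p∣≤0 : ∣ p ∣ ≤ 0
  ∣p∣≤0 = ≤-reflexive (trans (cong ∣_∣ (Empty-unique p-empty)) (∣⊥∣≡0 n))

≤-maxList : ∀ {x xs} → x ∈ˡ xs → x ≤ maxList xs
≤-maxList {xs = xs} x∈xs = foldr-preservesᵒ
  (λ a b → [ (λ x≤a → ≤-trans x≤a (m≤m⊔n a b)) , (λ x≤b → ≤-trans x≤b (m≤n⊔m a b)) ])
  0 xs (inj₂ (Any.map ≤-reflexive x∈xs))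

foldr-⊓-≤ : ∀ s xs {y} → y ∈ˡ xs → foldr _⊓_ s xs ≤ y
foldr-⊓-≤ s xs y∈xs = foldr-preservesᵒ
  (λ a b → [ (λ a≤y → ≤-trans (m⊓n≤m a b) a≤y) , (λ b≤y → ≤-trans (m⊓n≤n a b) b≤y) ])
  s xs (inj₂ (Any.map (≤-reflexive ∘ ≡-sym) y∈xs))

T-does⁺ : ∀ {p} {P : Set p} (P? : Dec P) → P → T (does P?)
T-does⁺ (yes _) _ = _
T-does⁺ (no ¬p) p = ¬p p

T-does⁻ : ∀ {p} {P : Set p} (P? : Dec P) → T (does P?) → P
T-does⁻ (yes p) _ = p

T-guard⁻ : ∀ {p} {P : Set p} a b (P? : Dec P) d →
           T (not (a ∧ b ∧ not (does P?)) ∨ d) → T a → T b → ¬ P → T d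
T-guard⁻ true true (no _)  d t _ _ _  = t
T-guard⁻ true true (yes p) d _ _ _ ¬p = contradiction p ¬p

T-guard⁺ : ∀ {p} {P : Set p} a b (P? : Dec P) d →
           (T a → T b → ¬ P → T d) → T (not (a ∧ b ∧ not (does P?)) ∨ d)
T-guard⁺ false b     P?      d _ = _
T-guard⁺ true  false P?      d _ = _
T-guard⁺ true  true  (yes _) d _ = _
T-guard⁺ true  true  (no ¬p) d h = h _ _ ¬p

allSubsets-complete : ∀ {n} (S : Subset n) → S ∈ˡ allSubsets n
allSubsets-complete []            = hereˡ refl
allSubsets-complete {suc n} (inside ∷ S) =
  ∈-++⁺ˡ (∈-map⁺ (inside ∷_) (allSubsets-complete S))
allSubsets-complete {suc n} (outside ∷ S) =
  ∈-++⁺ʳ (map (inside ∷_) (allSubsets n)) (∈-map⁺ (outside ∷_) (allSubsets-complete S))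

module _ {n : ℕ} (G : Graph n) where

  Clique : Subset n → Set
  Clique C = ∀ {i j} → i ∈ C → j ∈ C → i ≢ j → j ∈ N G i

  adj⇒∈N : ∀ {v x} → adj G v x ≡ true → x ∈ N G v
  adj⇒∈N {v} {x} e = lookup⇒[]= x (N G v) (trans (lookup∘tabulate (adj G v) x) e)

  ∈N⇒adj : ∀ {v x} → x ∈ N G v → adj G v x ≡ true
  ∈N⇒adj {v} {x} m = trans (≡-sym (lookup∘tabulate (adj G v) x)) ([]=⇒lookup m)

  ∈N-sym : ∀ {v x} → x ∈ N G v → v ∈ N G x
  ∈N-sym {v} {x} m = adj⇒∈N (trans (Graph.sym G x v) (∈N⇒adj m))

  x∉Nx : ∀ x → x ∉ N G x
  x∉Nx x m with trans (≡-sym (∈N⇒adj m)) (irrefl G x)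
  ... | ()

  x∉Ny∧x≢y⇒x∉N[y] : ∀ {x y} → x ∉ N G y → x ≢ y → x ∉ N[_] G y
  x∉Ny∧x≢y⇒x∉N[y] {x} {y} x∉Ny x≢y m with x∈p∪q⁻ (N G y) ⁅ y ⁆ m
  ... | inj₁ x∈Ny  = x∉Ny x∈Ny
  ... | inj₂ x∈⁅y⁆ = x≢y (x∈⁅y⁆⇒x≡y y x∈⁅y⁆)

  isClique⇒Clique : ∀ C → T (isClique G C) → Clique C
  isClique⇒Clique C isC {i} {j} i∈C j∈C i≢j = adj⇒∈N (Equivalence.to T-≡ $
    T-guard⁻ _ _ (i ≟ j) _ entry (T-∈ i∈C) (T-∈ j∈C) i≢j)
    where
    T-∈ : ∀ {x} → x ∈ C → T (lookup C x)
    T-∈ = Equivalence.from T-≡ ∘ []=⇒lookup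
    row   = All.lookup (all⁺ _ (allFin n) isC) (∈-allFin i)
    entry = All.lookup (all⁺ _ (allFin n) row) (∈-allFin j)

  Clique⇒isClique : ∀ C → Clique C → T (isClique G C)
  Clique⇒isClique C cl =
    all⁻ _ {allFin n} $ All.tabulate λ {i} _ → all⁻ _ {allFin n} $ All.tabulate λ {j} _ →
    T-guard⁺ _ _ (i ≟ j) _ λ Ti Tj i≢j →
      Equivalence.from T-≡ (∈N⇒adj (cl (∈-T Ti) (∈-T Tj) i≢j))
    where
    ∈-T : ∀ {x} → T (lookup C x) → x ∈ C
    ∈-T {x} = lookup⇒[]= x C ∘ Equivalence.to T-≡

  Clique-⊆ : ∀ {A B} → B ⊆ A → Clique A → Clique B
  Clique-⊆ B⊆A cl i∈B j∈B = cl (B⊆A i∈B) (B⊆A j∈B)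

  Clique-∪-apex : ∀ {C} u → Clique C → C ⊆ N G u → Clique (C ∪ ⁅ u ⁆)
  Clique-∪-apex {C} u cl C⊆Nu {i} {j} i∈ j∈ i≢j with x∈p∪q⁻ C ⁅ u ⁆ i∈ | x∈p∪q⁻ C ⁅ u ⁆ j∈
  ... | inj₁ i∈C | inj₁ j∈C = cl i∈C j∈C i≢j
  ... | inj₁ i∈C | inj₂ j∈u rewrite x∈⁅y⁆⇒x≡y u j∈u = ∈N-sym (C⊆Nu i∈C)
  ... | inj₂ i∈u | inj₁ j∈C rewrite x∈⁅y⁆⇒x≡y u i∈u = C⊆Nu j∈C
  ... | inj₂ i∈u | inj₂ j∈u = contradiction (trans (x∈⁅y⁆⇒x≡y u i∈u) (≡-sym (x∈⁅y⁆⇒x≡y u j∈u))) i≢j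

  Clique⇒K-x⊆Nx : ∀ {K x} → Clique K → x ∈ K → K - x ⊆ N G x
  Clique⇒K-x⊆Nx {K} cl x∈K y∈K-x = cl x∈K (p─q⊆p K _ y∈K-x) (≢-sym (x∈p-y⇒x≢y K y∈K-x))

  private
    isCliqueIn : Subset n → Subset n → Bool
    isCliqueIn S C = does (C ⊆? S) ∧ isClique G C

    cliquesIn : Subset n → List (Subset n)
    cliquesIn S = filterᵇ (isCliqueIn S) (allSubsets n)

    ∈-cliquesIn⁺ : ∀ {C S} → C ⊆ S → Clique C → C ∈ˡ cliquesIn S
    ∈-cliquesIn⁺ {C} {S} C⊆S cl = ∈-filter⁺ (T? ∘ _) (allSubsets-complete C)
      (Equivalence.from T-∧ (T-does⁺ (C ⊆? S) C⊆S , Clique⇒isClique C cl))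

    ∈-cliquesIn⁻ : ∀ {C S} → C ∈ˡ cliquesIn S → C ⊆ S × Clique C
    ∈-cliquesIn⁻ {C} {S} C∈ =
      let C⊆S , isC = Equivalence.to T-∧ (proj₂ (∈-filter⁻ (T? ∘ isCliqueIn S)
                                                              {xs = allSubsets n} C∈))
      in T-does⁻ (C ⊆? S) C⊆S , isClique⇒Clique C isC

    isDeletionIn : Subset n → ℕ → Subset n → Bool
    isDeletionIn S k T = does (T ⊆? S) ∧ (∣ T ∣ ≤ᵇ k)

    deletionsIn : Subset n → ℕ → List (Subset n)
    deletionsIn S k = filterᵇ (isDeletionIn S k) (allSubsets n)

    ∈-deletionsIn⁺ : ∀ {T S k} → T ⊆ S → ∣ T ∣ ≤ k → T ∈ˡ deletionsIn S k
    ∈-deletionsIn⁺ {T} {S} T⊆S ∣T∣≤k = ∈-filter⁺ (T? ∘ _) (allSubsets-complete T)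
      (Equivalence.from T-∧ (T-does⁺ (T ⊆? S) T⊆S , ≤⇒≤ᵇ ∣T∣≤k))

    ∈-deletionsIn⁻ : ∀ {T S k} → T ∈ˡ deletionsIn S k → T ⊆ S × ∣ T ∣ ≤ k
    ∈-deletionsIn⁻ {T} {S} {k} T∈ =
      let T⊆S , ∣T∣≤ᵇk = Equivalence.to T-∧ (proj₂ (∈-filter⁻ (T? ∘ isDeletionIn S k)
                                                                {xs = allSubsets n} T∈))
      in T-does⁻ (T ⊆? S) T⊆S , ≤ᵇ⇒≤ ∣ T ∣ k ∣T∣≤ᵇk

  ∣C∣≤ω : ∀ {C S} → C ⊆ S → Clique C → ∣ C ∣ ≤ ω G S
  ∣C∣≤ω C⊆S cl = ≤-maxList (∈-map⁺ ∣_∣ (∈-cliquesIn⁺ C⊆S cl))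

  ω-attained : ∀ S → ∃[ C ] C ⊆ S × Clique C × ∣ C ∣ ≡ ω G S
  ω-attained S with foldr-selective ⊔-sel 0 (map ∣_∣ (cliquesIn S))
  ... | inj₁ ω≡0 = ⊥ , ⊆-min S , (λ i∈⊥ → contradiction i∈⊥ ∉⊥) , trans (∣⊥∣≡0 n) (≡-sym ω≡0)
  ... | inj₂ ω∈  with ∈-map⁻ ∣_∣ ω∈
  ...   | C , C∈ , ω≡∣C∣ = let C⊆S , cl = ∈-cliquesIn⁻ C∈ in C , C⊆S , cl , ≡-sym ω≡∣C∣

  ω-lub : ∀ {S m} → (∀ {C} → C ⊆ S → Clique C → ∣ C ∣ ≤ m) → ω G S ≤ m
  ω-lub {S} bound = let C , C⊆S , cl , ∣C∣≡ω = ω-attained S in subst (_≤ _) ∣C∣≡ω (bound C⊆S cl)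

  ω-mono : ∀ {S S′} → S ⊆ S′ → ω G S ≤ ω G S′
  ω-mono S⊆S′ = ω-lub λ C⊆S → ∣C∣≤ω (S⊆S′ ∘ C⊆S)

  θ≤ω─ : ∀ {S T k} → T ⊆ S → ∣ T ∣ ≤ k → θ G S k ≤ ω G (S ─ T)
  θ≤ω─ {S} T⊆S ∣T∣≤k =
    foldr-⊓-≤ (ω G S) _ (∈-map⁺ (λ R → ω G (S ─ R)) (∈-deletionsIn⁺ T⊆S ∣T∣≤k))

  θ-glb : ∀ {S k m} → (∀ {T} → T ⊆ S → ∣ T ∣ ≤ k → m ≤ ω G (S ─ T)) → m ≤ θ G S k
  θ-glb {S} {k} {m} bound = foldr-preservesᵇ {P = m ≤_} ⊓-glb
    (subst (λ R → _ ≤ ω G R) (p─⊥≡p S) (bound (⊆-min S) (≤-trans (≤-reflexive (∣⊥∣≡0 n)) z≤n)))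
    (All-map⁺ (All.tabulate λ T∈ → let T⊆S , ∣T∣≤k = ∈-deletionsIn⁻ T∈ in bound T⊆S ∣T∣≤k))

  1+∣C∣≤ω-apex : ∀ {C R u} → Clique C → C ⊆ N G u → C ⊆ R → u ∈ R → suc ∣ C ∣ ≤ ω G R
  1+∣C∣≤ω-apex {C} {R} {u} cl C⊆Nu C⊆R u∈R =
    ≤-trans (x∉p⇒1+∣p∣≤∣p∪⁅x⁆∣ (x∉Nx u ∘ C⊆Nu)) (∣C∣≤ω C∪u⊆R (Clique-∪-apex u cl C⊆Nu))
    where
    C∪u⊆R : C ∪ ⁅ u ⁆ ⊆ R
    C∪u⊆R m with x∈p∪q⁻ C ⁅ u ⁆ m
    ... | inj₁ x∈C   = C⊆R x∈C
    ... | inj₂ x∈⁅u⁆ rewrite x∈⁅y⁆⇒x≡y u x∈⁅u⁆ = u∈R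

  ∣K∣≤1+ω⟨Nx⟩ : ∀ {K x} → Clique K → x ∈ K → ∣ K ∣ ≤ suc (ω G (N G x))
  ∣K∣≤1+ω⟨Nx⟩ {K} {x} cl x∈K =
    ≤-trans (∣p∣≤1+∣p-x∣ K x) (s≤s (∣C∣≤ω (Clique⇒K-x⊆Nx cl x∈K) (Clique-⊆ (p─q⊆p K _) cl)))

  θ⊤[1+k]≤θ[⊤-u]k : ∀ k u → θ G ⊤ (suc k) ≤ θ G (⊤ - u) k
  θ⊤[1+k]≤θ[⊤-u]k k u = θ-glb λ {T} _ ∣T∣≤k →
    subst (λ R → θ G ⊤ (suc k) ≤ ω G R) (⊤─T∪u≡⊤-u─T T)
      (θ≤ω─ ⊆⊤ (≤-trans (∣p∪⁅x⁆∣≤1+∣p∣ T u) (s≤s ∣T∣≤k)))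
    where
    ⊤─T∪u≡⊤-u─T : ∀ T → ⊤ ─ (T ∪ ⁅ u ⁆) ≡ (⊤ - u) ─ T
    ⊤─T∪u≡⊤-u─T T = begin
      ⊤ ─ (T ∪ ⁅ u ⁆) ≡⟨ ≡-sym (p─q─r≡p─q∪r ⊤ T ⁅ u ⁆) ⟩
      ⊤ ─ T ─ ⁅ u ⁆   ≡⟨ p─q─r≡p─r─q ⊤ T ⁅ u ⁆ ⟩
      (⊤ - u) ─ T     ∎
      where open ≡-Reasoning

  Dominant : ℕ → Fin n → Set
  Dominant k u = ∀ v → v ∉ N[_] G u → ω G (N G v) + k < ω G (N G u)

  module _ {k : ℕ} {u : Fin n} (dominant : Dominant k u) where

    1+∣L∣≤ω⟨⊤─S⟩ : ∀ {S L} → u ∉ S → ∣ S ∣ ≤ k → Clique L → L ⊆ ⊤ ─ S → u ∉ L →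
                   suc ∣ L ∣ ≤ ω G (⊤ ─ S)
    1+∣L∣≤ω⟨⊤─S⟩ {S} {L} u∉S ∣S∣≤k clL L⊆⊤─S u∉L with nonempty? (L ─ N G u)
    ... | no L─Nu-empty = 1+∣C∣≤ω-apex clL L⊆Nu L⊆⊤─S (x∈p∧x∉q⇒x∈p─q ∈⊤ u∉S)
      where
      L⊆Nu : L ⊆ N G u
      L⊆Nu {x} x∈L with x ∈? N G u
      ... | yes x∈Nu = x∈Nu
      ... | no  x∉Nu = contradiction (x , x∈p∧x∉q⇒x∈p─q x∈L x∉Nu) L─Nu-empty
    ... | yes (w , w∈L─Nu) with ω-attained (N G u)
    ...   | C , C⊆Nu , clC , ∣C∣≡ω⟨Nu⟩ = begin
      suc ∣ L ∣                 ≤⟨ s≤s (∣K∣≤1+ω⟨Nx⟩ clL w∈L) ⟩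
      suc (suc (ω G (N G w)))   ≤⟨ s≤s ω⟨Nw⟩<∣C─S∣ ⟩
      suc ∣ C ─ S ∣             ≤⟨ 1+∣C∣≤ω-apex (Clique-⊆ (p─q⊆p C S) clC) (C⊆Nu ∘ p─q⊆p C S)
                                                 C─S⊆⊤─S (x∈p∧x∉q⇒x∈p─q ∈⊤ u∉S) ⟩
      ω G (⊤ ─ S)               ∎
      where
      open ≤-Reasoning
      w∈L = p─q⊆p L _ w∈L─Nu
      w∉N[u] : w ∉ N[_] G u
      w∉N[u] = x∉Ny∧x≢y⇒x∉N[y] (x∈p─q⇒x∉q L _ w∈L─Nu) λ { refl → u∉L w∈L }
      C─S⊆⊤─S : C ─ S ⊆ ⊤ ─ S
      C─S⊆⊤─S x∈ = x∈p∧x∉q⇒x∈p─q ∈⊤ (x∈p─q⇒x∉q C S x∈)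
      ω⟨Nw⟩<∣C─S∣ : ω G (N G w) < ∣ C ─ S ∣
      ω⟨Nw⟩<∣C─S∣ = +-cancelʳ-< k _ _ (begin-strict
        ω G (N G w) + k   <⟨ dominant w w∉N[u] ⟩
        ω G (N G u)       ≡⟨ ≡-sym ∣C∣≡ω⟨Nu⟩ ⟩
        ∣ C ∣             ≤⟨ ∣p∣≤∣p─q∣+∣q∣ C S ⟩
        ∣ C ─ S ∣ + ∣ S ∣ ≤⟨ +-monoʳ-≤ ∣ C ─ S ∣ ∣S∣≤k ⟩
        ∣ C ─ S ∣ + k     ∎)

  θ[⊤-u]k≤θ⊤[1+k] : ∀ {k u} → Dominant (suc k) u → θ G (⊤ - u) k ≤ θ G ⊤ (suc k)
  θ[⊤-u]k≤θ⊤[1+k] {k} {u} dominant = θ-glb λ {S} _ ∣S∣≤1+k → θ[⊤-u]k≤ω⟨⊤─S⟩ S ∣S∣≤1+k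
    where
    θ[⊤-u]k≤ω⟨⊤─S⟩ : ∀ S → ∣ S ∣ ≤ suc k → θ G (⊤ - u) k ≤ ω G (⊤ ─ S)
    θ[⊤-u]k≤ω⟨⊤─S⟩ S ∣S∣≤1+k with u ∈? S
    ... | yes u∈S = ≤-trans (θ≤ω─ S-u⊆⊤-u ∣S-u∣≤k) (ω-mono ⊤-u─S-u⊆⊤─S)
      where
      S-u⊆⊤-u : S - u ⊆ ⊤ - u
      S-u⊆⊤-u x∈ = x∈p∧x≢y⇒x∈p-y ∈⊤ (x∈p-y⇒x≢y S x∈)
      ∣S-u∣≤k : ∣ S - u ∣ ≤ k
      ∣S-u∣≤k = s≤s⁻¹ (≤-trans (x∈p⇒∣p-x∣<∣p∣ u∈S) ∣S∣≤1+k)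
      ⊤-u─S-u⊆⊤─S : (⊤ - u) ─ (S - u) ⊆ ⊤ ─ S
      ⊤-u─S-u⊆⊤─S x∈ = x∈p∧x∉q⇒x∈p─q ∈⊤
        (x∉p-y∧x≢y⇒x∉p (x∈p─q⇒x∉q _ _ x∈) (x∈p-y⇒x≢y ⊤ (p─q⊆p _ _ x∈)))
    ... | no u∉S with ∣p∣≤1+k⇒∃∣p-x∣≤k S u ∣S∣≤1+k
    ...   | s , ∣S-s∣≤k = ≤-trans (θ≤ω─ S-s⊆⊤-u ∣S-s∣≤k) (ω-lub ∣K∣≤ω⟨⊤─S⟩)
      where
      S-s⊆⊤-u : S - s ⊆ ⊤ - u
      S-s⊆⊤-u x∈ = x∈p∧x≢y⇒x∈p-y ∈⊤ λ { refl → u∉S (p─q⊆p S _ x∈) }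
      ∣K∣≤ω⟨⊤─S⟩ : ∀ {K} → K ⊆ (⊤ - u) ─ (S - s) → Clique K → ∣ K ∣ ≤ ω G (⊤ ─ S)
      ∣K∣≤ω⟨⊤─S⟩ {K} K⊆ clK = ≤-trans (∣p∣≤1+∣p-x∣ K s)
        (1+∣L∣≤ω⟨⊤─S⟩ dominant u∉S ∣S∣≤1+k (Clique-⊆ (p─q⊆p K _) clK) K-s⊆⊤─S u∉K-s)
        where
        K-s⊆⊤─S : K - s ⊆ ⊤ ─ S
        K-s⊆⊤─S x∈ = x∈p∧x∉q⇒x∈p─q ∈⊤
          (x∉p-y∧x≢y⇒x∉p (x∈p─q⇒x∉q _ _ (K⊆ (p─q⊆p K _ x∈))) (x∈p-y⇒x≢y K x∈))
        u∉K-s : u ∉ K - s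
        u∉K-s u∈ = x∈p-y⇒x≢y ⊤ (p─q⊆p _ _ (K⊆ (p─q⊆p K _ u∈))) refl

lemma8 : {n : ℕ} (G : Graph n) (k : ℕ) (u : Fin n) → 0 < k →
    (∀ (v : Fin n) → v ∉ N[_] G u → ω G (N G v) + k < ω G (N G u)) →
    θ G ⊤ k ≡ θ G (⊤ - u) (k ∸ 1)
lemma8 G (suc k) u _ dominant =
  ≤-antisym (θ⊤[1+k]≤θ[⊤-u]k G k u) (θ[⊤-u]k≤θ⊤[1+k] G dominant)
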